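{- Let $U=U_1\cup\dots\cup U_n$, where $U_1,\dots,U_n\subseteq\mathbb N$ are almost basic sets with $U_i\cap U_j\neq\emptyset$ for all $i,j$. If $f:U\to\mathbb Z$ is such that the restriction of $f$ to each $U_i$ is a LIP function on $U_i$, then $f$ is a LIP function on $U$.
   Context: $\mathbb N=\{1,2,\dots\}$, $\mathbb N_0=\{0,1,2,\dots\}$. The Kirch topology on $\mathbb N$ has basis all arithmetic progressions $a+d\mathbb N_0$ with $a,d\in\mathbb N$, $\gcd(a,d)=1$, $d$ square-free. A basic set is an arithmetic progression $a+d\mathbb N_0$ with $\gcd(a,d)=1$, $d$ square-free, which is full, i.e. equals $(a+d\mathbb Z)\cap\mathbb N$. An almost basic set is a basic set minus a Kirch-closed subset of natural density zero. For an infinite $U\subseteq\mathbb Z$, a function $f:U\to\mathbb Z$ is LIP (locally integer polynomial) if for every finite $X\subseteq U$ there is a polynomial $p\in\mathbb Z[x]$ with $p(x)=f(x)$ for all $x\in X$. -}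

module Defs where

open import Data.Nat using (ℕ; _*_; _+_; _≤_)
open import Data.Nat.Divisibility using (_∣_)
open import Data.Nat.Coprimality using (Coprime)
open import Data.Integer as ℤ using (ℤ; +_)
open import Data.List using (List; []; _∷_; length)
open import Data.List.Relation.Unary.All using (All)
open import Data.List.Relation.Unary.Unique.Propositional using (Unique)
open import Data.Product using (Σ; ∃; _×_)
open import Relation.Nullary using (¬_)
open import Relation.Binary.PropositionalEquality using (_≡_)

-- Subsets of ℕ = {1,2,...} are predicates on Agda's ℕ; the element 0 is
-- never relevant (all sets below consist of positive naturals).
Pred : Set₁
Pred = ℕ → Set

AP : ℕ → ℕ → Pred
AP a d x = ∃ λ k → x ≡ a + k * d

SquareFree : ℕ → Set
SquareFree d = ∀ m → m * m ∣ d → m ≡ 1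

APℤ : ℕ → ℕ → Pred
APℤ a d x = ∃ λ (z : ℤ) → + x ≡ (+ a) ℤ.+ z ℤ.* (+ d)

record KirchAP (a d : ℕ) : Set where
  field
    a≥1     : 1 ≤ a
    d≥1     : 1 ≤ d
    coprime : Coprime a d
    sqfree  : SquareFree d

KirchOpen : Pred → Set
KirchOpen O = ∀ x → 1 ≤ x → O x →
  Σ ℕ λ a → Σ ℕ λ d → KirchAP a d × AP a d x × (∀ y → AP a d y → O y)

KirchClosed : Pred → Set
KirchClosed C = KirchOpen (λ x → ¬ C x)

-- natural density zero: for every k ≥ 1, eventually
-- k * #(C ∩ [1,n]) ≤ n  (counting via duplicate-free lists)
DensityZero : Pred → Set
DensityZero C = ∀ k → 1 ≤ k → Σ ℕ λ N → ∀ n → N ≤ n →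
  ∀ (xs : List ℕ) → Unique xs → All (λ x → C x × 1 ≤ x × x ≤ n) xs →
  k * length xs ≤ n

-- basic set: full Kirch progression a + dℕ₀ = (a + dℤ) ∩ ℕ
record BasicSet (a d : ℕ) : Set where
  field
    kirch : KirchAP a d
    full  : ∀ x → 1 ≤ x → (AP a d x → APℤ a d x) × (APℤ a d x → AP a d x)

AlmostBasic : Pred → Set₁
AlmostBasic U = Σ ℕ λ a → Σ ℕ λ d → BasicSet a d × Σ Pred λ C →
  KirchClosed C × DensityZero C ×
  (∀ x → (U x → AP a d x × ¬ C x) × (AP a d x × ¬ C x → U x))

-- integer polynomials as coefficient lists (constant term first)
evalPoly : List ℤ → ℤ → ℤ
evalPoly []       x = + 0
evalPoly (c ∷ cs) x = c ℤ.+ x ℤ.* evalPoly cs x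

-- f (a function on ℕ, only its values on U matter) is LIP on U
LIP : Pred → (ℕ → ℤ) → Set
LIP U f = ∀ (X : List ℕ) → All U X →
  Σ (List ℤ) λ p → All (λ x → evalPoly p (+ x) ≡ f x) X

module Submission where

-- By induction on n it suffices to glue a LIP function on V = U₂ ∪ … ∪ Uₙ with one on
-- W = U₁. Given finite A ⊆ V and B ⊆ W with A ∩ B = ∅, choose for each a ∈ A a point
-- c_a ∈ V ∩ W, all distinct, with c_a ≡ a (mod ∏_{b∈B} (a - b)). Then x - c_a lies in the
-- ideal (x - a, ∏_{b∈B} (x - b)) of ℤ[x], hence ∏ (x - c_a) = ∏ (x - a)·u + ∏ (x - b)·v.
-- If p₁ interpolates f on A ∪ C and p₂ on B ∪ C, where C = {c_a}, then
-- p₂ - p₁ = ∏ (x - c_a)·e and p₁ + ∏ (x - a)·u·e interpolates f on A ∪ B.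
--
-- The points c_a come from the Chinese remainder theorem, the congruences being compatible
-- because the modulus of the basic set of W is square-free and the two sets meet, together
-- with the fact that no arithmetic progression lies in a union of two density-zero sets. That fact only yields a doubly
-- negated existence, which is harmless: whether f has an integer interpolant on a finite
-- set is decidable, by Newton's divided differences.

open import Defs
open import Data.Nat using (ℕ; zero; suc)
open import Data.Fin using (Fin; zero; suc)
open import Data.Integer using (ℤ)
open import Data.List using ([])
open import Data.List.Relation.Unary.All as All using ()
open import Data.Product using (Σ; ∃; _×_; _,_; proj₁; proj₂)
open import Data.Sum using (_⊎_; inj₁; inj₂)
open import Function using (_∘_)

module IntegerPolynomials where

  open import Data.Integer using (+_; -_; _+_; _*_; _-_; 0ℤ; 1ℤ; -1ℤ)
  open import Data.Integer.Properties
    using (+-identityˡ; +-identityʳ; +-inverseʳ; *-identityˡ; *-zeroˡ; *-zeroʳ; *-assoc;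
           -1*i≡-i; i*j≡0⇒i≡0∨j≡0; i-j≡0⇒i≡j)
  open import Data.Integer.Divisibility.Signed using (_∣_; divides)
  open import Data.Integer.Tactic.RingSolver using (solve-∀)
  open import Data.List using (List; []; _∷_; map)
  open import Data.List.Membership.Propositional using (_∈_; _∉_)
  open import Data.List.Relation.Unary.All using (All; []; _∷_)
  open import Data.List.Relation.Unary.Any using (here; there)
  open import Data.List.Relation.Unary.Unique.Propositional using (Unique; []; _∷_)
  open import Data.Product using (∃₂; _,_)
  open import Data.Sum using (inj₁; inj₂)
  open import Function using (_∘_)
  open import Relation.Nullary using (contradiction)
  open import Relation.Binary.PropositionalEquality

  IsPolynomial : (ℤ → ℤ) → Set
  IsPolynomial g = Σ (List ℤ) λ p → ∀ x → evalPoly p x ≡ g x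

  evalPolyᴾ : ∀ p → IsPolynomial (evalPoly p)
  evalPolyᴾ p = p , λ _ → refl

  addCoeffs : List ℤ → List ℤ → List ℤ
  addCoeffs []      q       = q
  addCoeffs (a ∷ p) []      = a ∷ p
  addCoeffs (a ∷ p) (b ∷ q) = a + b ∷ addCoeffs p q

  evalPoly-addCoeffs : ∀ p q x → evalPoly (addCoeffs p q) x ≡ evalPoly p x + evalPoly q x
  evalPoly-addCoeffs []      q       x = sym (+-identityˡ _)
  evalPoly-addCoeffs (a ∷ p) []      x = sym (+-identityʳ _)
  evalPoly-addCoeffs (a ∷ p) (b ∷ q) x =
    trans (cong (λ s → a + b + x * s) (evalPoly-addCoeffs p q x)) (shuffle a b x _ _)
    where
    shuffle : ∀ a b x s t → a + b + x * (s + t) ≡ a + x * s + (b + x * t)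
    shuffle = solve-∀

  scaleCoeffs : ℤ → List ℤ → List ℤ
  scaleCoeffs c = map (c *_)

  evalPoly-scaleCoeffs : ∀ c p x → evalPoly (scaleCoeffs c p) x ≡ c * evalPoly p x
  evalPoly-scaleCoeffs c []      x = sym (*-zeroʳ c)
  evalPoly-scaleCoeffs c (a ∷ p) x =
    trans (cong (λ s → c * a + x * s) (evalPoly-scaleCoeffs c p x)) (shuffle c a x _)
    where
    shuffle : ∀ c a x s → c * a + x * (c * s) ≡ c * (a + x * s)
    shuffle = solve-∀

  mulCoeffs : List ℤ → List ℤ → List ℤ
  mulCoeffs []      q = []
  mulCoeffs (a ∷ p) q = addCoeffs (scaleCoeffs a q) (0ℤ ∷ mulCoeffs p q)

  evalPoly-mulCoeffs : ∀ p q x → evalPoly (mulCoeffs p q) x ≡ evalPoly p x * evalPoly q x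
  evalPoly-mulCoeffs []      q x = sym (*-zeroˡ (evalPoly q x))
  evalPoly-mulCoeffs (a ∷ p) q x = begin
    evalPoly (addCoeffs (scaleCoeffs a q) (0ℤ ∷ mulCoeffs p q)) x
      ≡⟨ evalPoly-addCoeffs (scaleCoeffs a q) (0ℤ ∷ mulCoeffs p q) x ⟩
    evalPoly (scaleCoeffs a q) x + (0ℤ + x * evalPoly (mulCoeffs p q) x)
      ≡⟨ cong₂ (λ s t → s + (0ℤ + x * t)) (evalPoly-scaleCoeffs a q x) (evalPoly-mulCoeffs p q x) ⟩
    a * evalPoly q x + (0ℤ + x * (evalPoly p x * evalPoly q x))
      ≡⟨ shuffle a x _ _ ⟩
    (a + x * evalPoly p x) * evalPoly q x ∎
    where
    open ≡-Reasoning
    shuffle : ∀ a x s t → a * t + (0ℤ + x * (s * t)) ≡ (a + x * s) * t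
    shuffle = solve-∀

  infixl 6 _+ᴾ_ _-ᴾ_
  infixl 7 _*ᴾ_

  constᴾ : ∀ c → IsPolynomial (λ _ → c)
  constᴾ c = c ∷ [] , λ x → trans (cong (λ s → c + s) (*-zeroʳ x)) (+-identityʳ c)

  idᴾ : IsPolynomial (λ x → x)
  idᴾ = 0ℤ ∷ 1ℤ ∷ [] , eval
    where
    eval : ∀ x → 0ℤ + x * (1ℤ + x * 0ℤ) ≡ x
    eval = solve-∀

  _+ᴾ_ : ∀ {g h} → IsPolynomial g → IsPolynomial h → IsPolynomial (λ x → g x + h x)
  (p , p≡g) +ᴾ (q , q≡h) =
    addCoeffs p q , λ x → trans (evalPoly-addCoeffs p q x) (cong₂ _+_ (p≡g x) (q≡h x))

  _*ᴾ_ : ∀ {g h} → IsPolynomial g → IsPolynomial h → IsPolynomial (λ x → g x * h x)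
  (p , p≡g) *ᴾ (q , q≡h) =
    mulCoeffs p q , λ x → trans (evalPoly-mulCoeffs p q x) (cong₂ _*_ (p≡g x) (q≡h x))

  -ᴾ_ : ∀ {g} → IsPolynomial g → IsPolynomial (λ x → - g x)
  -ᴾ_ {g} (p , p≡g) = scaleCoeffs -1ℤ p , λ x →
    trans (evalPoly-scaleCoeffs -1ℤ p x) (trans (cong (-1ℤ *_) (p≡g x)) (-1*i≡-i (g x)))

  _-ᴾ_ : ∀ {g h} → IsPolynomial g → IsPolynomial h → IsPolynomial (λ x → g x - h x)
  P -ᴾ Q = P +ᴾ -ᴾ Q

  syntheticDivision : ∀ p c → ∃ λ q → ∀ x → evalPoly p x ≡ (x - c) * evalPoly q x + evalPoly p c
  syntheticDivision []      c =
    [] , λ x → sym (trans (cong (_+ 0ℤ) (*-zeroʳ (x - c))) (+-identityʳ 0ℤ))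
  syntheticDivision (a ∷ p) c with q , p≡ ← syntheticDivision p c =
    evalPoly p c ∷ q , λ x → trans (cong (λ s → a + x * s) (p≡ x)) (shuffle a x c _ _)
    where
    shuffle : ∀ a x c r s → a + x * ((x - c) * s + r) ≡ (x - c) * (r + x * s) + (a + c * r)
    shuffle = solve-∀

  remainder-theorem : ∀ {g} → IsPolynomial g → ∀ c →
    ∃ λ q → IsPolynomial q × ∀ x → g x ≡ (x - c) * q x + g c
  remainder-theorem {g} (p , p≡g) c with q , p≡ ← syntheticDivision p c =
    evalPoly q , evalPolyᴾ q , λ x →
      trans (sym (p≡g x)) (trans (p≡ x) (cong (λ r → (x - c) * evalPoly q x + r) (p≡g c)))

  factor-linear : ∀ {g c} → IsPolynomial g → g c ≡ 0ℤ →
    ∃ λ q → IsPolynomial q × ∀ x → g x ≡ (x - c) * q x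
  factor-linear {g} {c} G gc≡0 with q , Q , g≡ ← remainder-theorem G c =
    q , Q , λ x → trans (g≡ x) (trans (cong (λ r → (x - c) * q x + r) gc≡0) (+-identityʳ _))

  rootProduct : List ℤ → ℤ → ℤ
  rootProduct []       x = 1ℤ
  rootProduct (c ∷ cs) x = (x - c) * rootProduct cs x

  rootProductᴾ : ∀ cs → IsPolynomial (rootProduct cs)
  rootProductᴾ []       = constᴾ 1ℤ
  rootProductᴾ (c ∷ cs) = (idᴾ -ᴾ constᴾ c) *ᴾ rootProductᴾ cs

  rootProduct-root : ∀ {c cs} → c ∈ cs → rootProduct cs c ≡ 0ℤ
  rootProduct-root {c} {_ ∷ cs} (here refl) =
    trans (cong (_* rootProduct cs c) (+-inverseʳ c)) (*-zeroˡ (rootProduct cs c))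
  rootProduct-root {c} {d ∷ _} (there c∈cs) =
    trans (cong ((c - d) *_) (rootProduct-root c∈cs)) (*-zeroʳ (c - d))

  rootProduct-nonroot : ∀ {c cs} → c ∉ cs → rootProduct cs c ≢ 0ℤ
  rootProduct-nonroot {c} {d ∷ cs} c∉ ∏≡0 with i*j≡0⇒i≡0∨j≡0 (c - d) ∏≡0
  ... | inj₁ c-d≡0 = c∉ (here (i-j≡0⇒i≡j c d c-d≡0))
  ... | inj₂ ∏≡0′  = rootProduct-nonroot (c∉ ∘ there) ∏≡0′

  quotient-vanishes : ∀ {g q : ℤ → ℤ} {c ds} → (∀ x → g x ≡ (x - c) * q x) →
    All (c ≢_) ds → All (λ d → g d ≡ 0ℤ) ds → All (λ d → q d ≡ 0ℤ) ds
  quotient-vanishes g≡ [] [] = []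
  quotient-vanishes {g} {q} {c} {d ∷ _} g≡ (c≢d ∷ c≢ds) (gd≡0 ∷ gds≡0)
    with i*j≡0⇒i≡0∨j≡0 (d - c) (trans (sym (g≡ d)) gd≡0)
  ... | inj₁ d-c≡0 = contradiction (sym (i-j≡0⇒i≡j d c d-c≡0)) c≢d
  ... | inj₂ qd≡0  = qd≡0 ∷ quotient-vanishes g≡ c≢ds gds≡0

  factor-theorem : ∀ {g cs} → IsPolynomial g → Unique cs → All (λ c → g c ≡ 0ℤ) cs →
    ∃ λ e → IsPolynomial e × ∀ x → g x ≡ rootProduct cs x * e x
  factor-theorem {g} G [] [] = g , G , λ x → sym (*-identityˡ (g x))
  factor-theorem {g} {c ∷ cs} G (c∉cs ∷ cs!) (gc≡0 ∷ g[cs]≡0)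
    with q , Q , g≡ ← factor-linear G gc≡0
    with e , E , q≡ ← factor-theorem Q cs! (quotient-vanishes g≡ c∉cs g[cs]≡0) =
    e , E , λ x → trans (g≡ x)
      (trans (cong ((x - c) *_) (q≡ x)) (sym (*-assoc (x - c) (rootProduct cs x) (e x))))

  infix 4 _∈⟨_,_⟩

  _∈⟨_,_⟩ : (ℤ → ℤ) → (ℤ → ℤ) → (ℤ → ℤ) → Set
  g ∈⟨ α , β ⟩ = ∃₂ λ u v → IsPolynomial u × IsPolynomial v × ∀ x → g x ≡ α x * u x + β x * v x

  1∈⟨1,β⟩ : ∀ β → (λ _ → 1ℤ) ∈⟨ (λ _ → 1ℤ) , β ⟩
  1∈⟨1,β⟩ β = (λ _ → 1ℤ) , (λ _ → 0ℤ) , constᴾ 1ℤ , constᴾ 0ℤ , λ x → shuffle (β x)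
    where
    shuffle : ∀ b → 1ℤ ≡ 1ℤ * 1ℤ + b * 0ℤ
    shuffle = solve-∀

  ∈⟨⟩-* : ∀ {α α′ β g h} → IsPolynomial α → IsPolynomial h →
    g ∈⟨ α , β ⟩ → h ∈⟨ α′ , β ⟩ → (λ x → g x * h x) ∈⟨ (λ x → α x * α′ x) , β ⟩
  ∈⟨⟩-* {α} {α′} {β} {g} {h} A H (u₁ , v₁ , U₁ , V₁ , g≡) (u₂ , v₂ , U₂ , V₂ , h≡) =
    (λ x → u₁ x * u₂ x) , (λ x → α x * u₁ x * v₂ x + v₁ x * h x) ,
    U₁ *ᴾ U₂ , A *ᴾ U₁ *ᴾ V₂ +ᴾ V₁ *ᴾ H , λ x → begin
      g x * h x                                   ≡⟨ cong (_* h x) (g≡ x) ⟩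
      (α x * u₁ x + β x * v₁ x) * h x             ≡⟨ cong (λ k → (α x * u₁ x + β x * v₁ x) * k) (h≡ x) ⟩
      (α x * u₁ x + β x * v₁ x) * (α′ x * u₂ x + β x * v₂ x)
        ≡⟨ expand (α x) (α′ x) (β x) (u₁ x) (v₁ x) (u₂ x) (v₂ x) ⟩
      α x * α′ x * (u₁ x * u₂ x) + β x * (α x * u₁ x * v₂ x + v₁ x * (α′ x * u₂ x + β x * v₂ x))
        ≡⟨ cong (λ k → α x * α′ x * (u₁ x * u₂ x) + β x * (α x * u₁ x * v₂ x + v₁ x * k)) (h≡ x) ⟨
      α x * α′ x * (u₁ x * u₂ x) + β x * (α x * u₁ x * v₂ x + v₁ x * h x) ∎
    where
    open ≡-Reasoning
    expand : ∀ a a′ b u₁ v₁ u₂ v₂ → (a * u₁ + b * v₁) * (a′ * u₂ + b * v₂) ≡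
      a * a′ * (u₁ * u₂) + b * (a * u₁ * v₂ + v₁ * (a′ * u₂ + b * v₂))
    expand = solve-∀

  -- Reducing β modulo x - a leaves the constant β a, which divides c - a.
  linear-∈⟨⟩ : ∀ {β a c} → IsPolynomial β → β a ∣ c - a →
    (λ x → x - c) ∈⟨ (λ x → x - a) , β ⟩
  linear-∈⟨⟩ {β} {a} {c} B (divides k c-a≡) with q , Q , β≡ ← remainder-theorem B a =
    (λ x → 1ℤ + k * q x) , (λ _ → - k) , constᴾ 1ℤ +ᴾ constᴾ k *ᴾ Q , constᴾ (- k) , λ x → begin
      x - c                                    ≡⟨ split x a c ⟩
      x - a - (c - a)                          ≡⟨ cong (λ d → x - a - d) c-a≡ ⟩
      x - a - k * β a                          ≡⟨ reduce x a k (q x) (β a) ⟩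
      (x - a) * (1ℤ + k * q x) + ((x - a) * q x + β a) * - k
        ≡⟨ cong (λ b → (x - a) * (1ℤ + k * q x) + b * - k) (β≡ x) ⟨
      (x - a) * (1ℤ + k * q x) + β x * - k     ∎
    where
    open ≡-Reasoning
    split : ∀ x a c → x - c ≡ x - a - (c - a)
    split = solve-∀
    reduce : ∀ x a k q r → x - a - k * r ≡ (x - a) * (1ℤ + k * q) + ((x - a) * q + r) * - k
    reduce = solve-∀

open IntegerPolynomials

module Interpolation where

  open import Data.Nat as ℕ using (_≟_)
  open import Data.Integer using (+_; _+_; _*_; _-_; 0ℤ)
  open import Data.Integer.Properties using (+-injective; *-comm; *-cancelˡ-≡; i-j≡0⇒i≡j)
  import Data.Integer.Base as ℤ
  open import Data.Integer.Divisibility.Signed using (_∣_; divides; _∣?_)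
  open import Data.Integer.Tactic.RingSolver using (solve-∀)
  open import Data.List using (List; []; _∷_; deduplicate)
  open import Data.List.Relation.Binary.Subset.Propositional using (_⊆_)
  open import Data.List.Relation.Unary.All as All using (All; []; _∷_; all?)
  import Data.List.Relation.Unary.All.Properties as All
  open import Data.List.Relation.Unary.Unique.Propositional using (Unique; []; _∷_)
  open import Data.List.Relation.Unary.Unique.DecPropositional.Properties _≟_ using (deduplicate-!)
  open import Data.Product using (_,_; uncurry)
  open import Relation.Nullary using (¬_; Dec; yes; no; contradiction)
  open import Relation.Nullary.Decidable using (map′; _×-dec_; decidable-stable)
  open import Relation.Binary.PropositionalEquality

  Interpolable : (ℕ → ℤ) → List ℕ → Set
  Interpolable f X = Σ (List ℤ) λ p → All (λ x → evalPoly p (+ x) ≡ f x) X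

  interpolable-⊆ : ∀ {f X Y} → Y ⊆ X → Interpolable f X → Interpolable f Y
  interpolable-⊆ Y⊆X (p , p≡f) = p , All.tabulate (λ y∈Y → All.lookup p≡f (Y⊆X y∈Y))

  -- Junk value 0 when k does not divide z.
  exactQuotient : ℤ → ℤ → ℤ
  exactQuotient k z with k ∣? z
  ... | yes k∣z = _∣_.quotient k∣z
  ... | no  _   = 0ℤ

  exactQuotient-correct : ∀ {k z} → k ∣ z → z ≡ exactQuotient k z * k
  exactQuotient-correct {k} {z} k∣z with k ∣? z
  ... | yes k∣z′ = _∣_.equality k∣z′
  ... | no  k∤z  = contradiction k∣z k∤z

  exactQuotient-unique : ∀ {k z w} → k ≢ 0ℤ → z ≡ k * w → exactQuotient k z ≡ w
  exactQuotient-unique {k} {z} {w} k≢0 z≡kw = *-cancelˡ-≡ k _ w (begin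
    k * exactQuotient k z  ≡⟨ *-comm k _ ⟩
    exactQuotient k z * k  ≡⟨ exactQuotient-correct (divides w (trans z≡kw (*-comm k w))) ⟨
    z                      ≡⟨ z≡kw ⟩
    k * w                  ∎)
    where
    open ≡-Reasoning
    instance _ = ℤ.≢-nonZero k≢0

  dividedDifference : (ℕ → ℤ) → ℕ → ℕ → ℤ
  dividedDifference f x₀ y = exactQuotient (+ y - + x₀) (f y - f x₀)

  interpolant-slope : ∀ {f x₀ xs} → Interpolable f (x₀ ∷ xs) →
    ∃ λ q → IsPolynomial q × All (λ y → f y - f x₀ ≡ (+ y - + x₀) * q (+ y)) xs
  interpolant-slope {f} {x₀} (p , px₀≡ ∷ p≡f) with q , Q , p≡ ← remainder-theorem (evalPolyᴾ p) (+ x₀) =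
    q , Q , All.map slope p≡f
    where
    slope : ∀ {y} → evalPoly p (+ y) ≡ f y → f y - f x₀ ≡ (+ y - + x₀) * q (+ y)
    slope {y} py≡ = begin
      f y - f x₀                                                      ≡⟨ cong₂ _-_ py≡ px₀≡ ⟨
      evalPoly p (+ y) - evalPoly p (+ x₀)                            ≡⟨ cong (_- _) (p≡ (+ y)) ⟩
      (+ y - + x₀) * q (+ y) + evalPoly p (+ x₀) - evalPoly p (+ x₀)  ≡⟨ cancel _ _ ⟩
      (+ y - + x₀) * q (+ y)                                          ∎
      where
      open ≡-Reasoning
      cancel : ∀ s r → s + r - r ≡ s
      cancel = solve-∀

  interpolable⇒divisible : ∀ {f x₀ xs} → Interpolable f (x₀ ∷ xs) →
    All (λ y → + y - + x₀ ∣ f y - f x₀) xs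
  interpolable⇒divisible I with q , _ , slopes ← interpolant-slope I =
    All.map (λ {y} s → divides (q (+ y)) (trans s (*-comm _ (q (+ y))))) slopes

  interpolable⇒dividedDifference : ∀ {f x₀ xs} → All (x₀ ≢_) xs → Interpolable f (x₀ ∷ xs) →
    Interpolable (dividedDifference f x₀) xs
  interpolable⇒dividedDifference {f} {x₀} x₀∉xs I with q , (r , r≡q) , slopes ← interpolant-slope I =
    r , All.zipWith (λ { (x₀≢y , s) → trans (r≡q _) (sym (exactQuotient-unique (y-x₀≢0 x₀≢y) s)) })
                    (x₀∉xs , slopes)
    where
    y-x₀≢0 : ∀ {y} → x₀ ≢ y → + y - + x₀ ≢ 0ℤ
    y-x₀≢0 x₀≢y y-x₀≡0 = x₀≢y (sym (+-injective (i-j≡0⇒i≡j _ _ y-x₀≡0)))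

  newton-step : ∀ {f x₀ xs} → All (λ y → + y - + x₀ ∣ f y - f x₀) xs →
    Interpolable (dividedDifference f x₀) xs → Interpolable f (x₀ ∷ xs)
  newton-step {f} {x₀} divisible (q , q≡) =
    proj₁ P , interpolates (+ x₀) (shift (f x₀) (+ x₀) (evalPoly q (+ x₀)))
            ∷ All.zipWith (λ { (d , qy≡) → interpolates _ (newton qy≡ d) }) (divisible , q≡)
    where
    P : IsPolynomial (λ x → f x₀ + (x - + x₀) * evalPoly q x)
    P = constᴾ (f x₀) +ᴾ (idᴾ -ᴾ constᴾ (+ x₀)) *ᴾ evalPolyᴾ q
    interpolates : ∀ {y} x → f x₀ + (x - + x₀) * evalPoly q x ≡ f y → evalPoly (proj₁ P) x ≡ f y
    interpolates x eq = trans (proj₂ P x) eq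
    shift : ∀ a x r → a + (x - x) * r ≡ a
    shift = solve-∀
    newton : ∀ {y} → evalPoly q (+ y) ≡ dividedDifference f x₀ y → + y - + x₀ ∣ f y - f x₀ →
      f x₀ + (+ y - + x₀) * evalPoly q (+ y) ≡ f y
    newton {y} qy≡ d = begin
      f x₀ + (+ y - + x₀) * evalPoly q (+ y)          ≡⟨ cong (λ r → f x₀ + (+ y - + x₀) * r) qy≡ ⟩
      f x₀ + (+ y - + x₀) * dividedDifference f x₀ y  ≡⟨ cong (λ r → f x₀ + r) fy-fx₀≡ ⟨
      f x₀ + (f y - f x₀)                             ≡⟨ restore (f x₀) (f y) ⟩
      f y                                             ∎
      where
      open ≡-Reasoning
      fy-fx₀≡ : f y - f x₀ ≡ (+ y - + x₀) * dividedDifference f x₀ y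
      fy-fx₀≡ = trans (exactQuotient-correct d) (*-comm (dividedDifference f x₀ y) _)
      restore : ∀ a b → a + (b - a) ≡ b
      restore = solve-∀

  interpolable-unique? : ∀ f X → Unique X → Dec (Interpolable f X)
  interpolable-unique? f []        _             = yes ([] , [])
  interpolable-unique? f (x₀ ∷ xs) (x₀∉xs ∷ xs!) =
    map′ (uncurry newton-step)
         (λ I → interpolable⇒divisible I , interpolable⇒dividedDifference x₀∉xs I)
         (all? (λ y → + y - + x₀ ∣? f y - f x₀) xs
            ×-dec interpolable-unique? (dividedDifference f x₀) xs xs!)

  interpolable? : ∀ f X → Dec (Interpolable f X)
  interpolable? f X =
    map′ (λ (p , p≡f) → p , All.deduplicate⁻ _≟_ (λ { refl eq → eq }) X p≡f)
         (λ (p , p≡f) → p , All.deduplicate⁺ _≟_ p≡f)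
         (interpolable-unique? f (deduplicate _≟_ X) (deduplicate-! X))

  interpolable-stable : ∀ {f X} → ¬ ¬ Interpolable f X → Interpolable f X
  interpolable-stable {f} {X} = decidable-stable (interpolable? f X)

open Interpolation

module Gluing where

  open import Data.Nat as ℕ using (_<_; _≟_)
  open import Data.Nat.Properties using (<⇒≱; ≤-reflexive)
  open import Function using (_∘_)
  open import Data.Integer using (+_; _+_; _*_; _-_; 0ℤ)
  open import Data.Integer.Properties using (+-injective; +-inverseʳ)
  open import Data.Integer.Divisibility.Signed using (_∣_)
  open import Data.Integer.Tactic.RingSolver using (solve-∀)
  open import Data.List using (List; []; _∷_; _++_; map; filter)
  open import Data.List.Extrema.Nat using (max; v≤max⁺)
  open import Data.List.Membership.Propositional using (_∈_; _∉_)
  open import Data.List.Membership.Propositional.Properties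
    using (∈-++⁺ˡ; ∈-++⁺ʳ; ∈-++⁻; ∈-filter⁺; ∈-map⁺)
  open import Data.List.Membership.DecPropositional _≟_ using (_∈?_; _∉?_)
  open import Data.List.Relation.Binary.Subset.Propositional using (_⊆_)
  open import Data.List.Relation.Binary.Subset.Propositional.Properties using (∷⁺ʳ)
  open import Data.List.Relation.Unary.All as All using (All; []; _∷_)
  import Data.List.Relation.Unary.All.Properties as All
  open import Data.List.Relation.Unary.Any as Any using (here; there)
  import Data.List.Relation.Unary.Unique.Propositional.Properties as Unique
  open import Data.List.Relation.Unary.Unique.Propositional using (Unique; []; _∷_)
  open import Data.Product using (∃₂; _,_)
  open import Data.Sum using (_⊎_; inj₁; inj₂; [_,_]′)
  open import Effect.Monad using (RawMonad)
  open import Relation.Nullary using (¬_; yes; no)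
  open import Relation.Nullary.Negation using (¬¬-Monad; ¬¬-map)
  open import Relation.Binary.PropositionalEquality

  LIP-mono : ∀ {U U′ f} → (∀ {x} → U′ x → U x) → LIP U f → LIP U′ f
  LIP-mono U′⊆U lip X X⊆U′ = lip X (All.map U′⊆U X⊆U′)

  partition-⊎ : ∀ {P Q : Pred} {X} → All (λ x → P x ⊎ Q x) X →
    ∃₂ λ A B → All P A × All Q B × X ⊆ A ++ B
  partition-⊎ [] = [] , [] , [] , [] , λ ()
  partition-⊎ {X = x ∷ _} (inj₁ px ∷ pqs) with A , B , pA , qB , X⊆ ← partition-⊎ pqs =
    x ∷ A , B , px ∷ pA , qB , ∷⁺ʳ x X⊆
  partition-⊎ {X = x ∷ _} (inj₂ qx ∷ pqs) with A , B , pA , qB , X⊆ ← partition-⊎ pqs =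
    A , x ∷ B , pA , qx ∷ qB , λ
      { (here refl)  → ∈-++⁺ʳ A (here refl)
      ; (there y∈X) → [ ∈-++⁺ˡ , ∈-++⁺ʳ A ∘ there ]′ (∈-++⁻ A (X⊆ y∈X)) }

  -- All that gluing LIP functions on V and on W requires of the two sets.
  Bridge : Pred → Pred → Set
  Bridge V W = ∀ {a} → V a → ∀ {B} → All W B → a ∉ B → ∀ K →
    ¬ ¬ (∃ λ c → K < c × V c × W c × rootProduct (map +_ B) (+ a) ∣ + c - + a)

  glue : ∀ {p₁ p₂ γ e α u β v : ℤ → ℤ} →
    IsPolynomial p₁ → IsPolynomial α → IsPolynomial u → IsPolynomial e →
    (∀ x → p₂ x - p₁ x ≡ γ x * e x) → (∀ x → γ x ≡ α x * u x + β x * v x) →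
    ∃ λ q → IsPolynomial q × (∀ x → α x ≡ 0ℤ → q x ≡ p₁ x) × (∀ x → β x ≡ 0ℤ → q x ≡ p₂ x)
  glue {p₁} {p₂} {γ} {e} {α} {u} {β} {v} P₁ A U E p₂-p₁≡ γ≡ =
    (λ x → p₁ x + α x * u x * e x) , P₁ +ᴾ A *ᴾ U *ᴾ E , on-α-zeros , on-β-zeros
    where
    open ≡-Reasoning
    on-α-zeros : ∀ x → α x ≡ 0ℤ → p₁ x + α x * u x * e x ≡ p₁ x
    on-α-zeros x αx≡0 = begin
      p₁ x + α x * u x * e x  ≡⟨ cong (λ a → p₁ x + a * u x * e x) αx≡0 ⟩
      p₁ x + 0ℤ * u x * e x   ≡⟨ shuffle (p₁ x) (u x) (e x) ⟩
      p₁ x                    ∎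
      where
      shuffle : ∀ p u e → p + 0ℤ * u * e ≡ p
      shuffle = solve-∀
    on-β-zeros : ∀ x → β x ≡ 0ℤ → p₁ x + α x * u x * e x ≡ p₂ x
    on-β-zeros x βx≡0 = begin
      p₁ x + α x * u x * e x                 ≡⟨ shuffle (p₁ x) (α x) (u x) (e x) (v x) ⟩
      p₁ x + (α x * u x + 0ℤ * v x) * e x    ≡⟨ cong (λ b → p₁ x + (α x * u x + b * v x) * e x) βx≡0 ⟨
      p₁ x + (α x * u x + β x * v x) * e x   ≡⟨ cong (λ g → p₁ x + g * e x) (γ≡ x) ⟨
      p₁ x + γ x * e x                       ≡⟨ cong (λ d → p₁ x + d) (p₂-p₁≡ x) ⟨
      p₁ x + (p₂ x - p₁ x)                   ≡⟨ restore (p₁ x) (p₂ x) ⟩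
      p₂ x                                   ∎
      where
      shuffle : ∀ p α u e v → p + α * u * e ≡ p + (α * u + 0ℤ * v) * e
      shuffle = solve-∀
      restore : ∀ a b → a + (b - a) ≡ b
      restore = solve-∀

  max<⇒∉ : ∀ {c xs} → max 0 xs < c → c ∉ xs
  max<⇒∉ {xs = xs} max<c c∈xs = <⇒≱ max<c (v≤max⁺ 0 xs (inj₂ (Any.map ≤-reflexive c∈xs)))

  difference-vanishes : ∀ {f : ℕ → ℤ} {p₁ p₂ Cs} →
    All (λ x → evalPoly p₁ (+ x) ≡ f x) Cs → All (λ x → evalPoly p₂ (+ x) ≡ f x) Cs →
    All (λ c → evalPoly p₂ c - evalPoly p₁ c ≡ 0ℤ) (map +_ Cs)
  difference-vanishes {f} {p₁} {p₂} p₁≡f p₂≡f = All.map⁺ (All.zipWith vanish (p₁≡f , p₂≡f))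
    where
    vanish : ∀ {x} → evalPoly p₁ (+ x) ≡ f x × evalPoly p₂ (+ x) ≡ f x →
      evalPoly p₂ (+ x) - evalPoly p₁ (+ x) ≡ 0ℤ
    vanish {x} (p₁≡ , p₂≡) = trans (cong₂ _-_ p₂≡ p₁≡) (+-inverseʳ (f x))

  glue-interpolants : ∀ {f A B Cs} → Unique Cs →
    rootProduct (map +_ Cs) ∈⟨ rootProduct (map +_ A) , rootProduct (map +_ B) ⟩ →
    Interpolable f (A ++ Cs) → Interpolable f (B ++ Cs) → Interpolable f (A ++ B)
  glue-interpolants {f} {A} {B} {Cs} Cs! (u , v , U , _ , ∏Cs≡) (p₁ , p₁≡f) (p₂ , p₂≡f)
    with p₁≡f[A] , p₁≡f[Cs] ← All.++⁻ A p₁≡f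
       | p₂≡f[B] , p₂≡f[Cs] ← All.++⁻ B p₂≡f
    with e , E , p₂-p₁≡ ← factor-theorem (evalPolyᴾ p₂ -ᴾ evalPolyᴾ p₁) (Unique.map⁺ +-injective Cs!)
                            (difference-vanishes {f} {p₁} {p₂} p₁≡f[Cs] p₂≡f[Cs])
    with q , (r , r≡q) , q≡p₁ , q≡p₂ ← glue {p₂ = evalPoly p₂} (evalPolyᴾ p₁) (rootProductᴾ (map +_ A))
                                            U E p₂-p₁≡ ∏Cs≡ =
    r , All.++⁺ (All.tabulate (agree {p₁} q≡p₁ p₁≡f[A])) (All.tabulate (agree {p₂} q≡p₂ p₂≡f[B]))
    where
    agree : ∀ {p X} → (∀ x → rootProduct (map +_ X) x ≡ 0ℤ → q x ≡ evalPoly p x) →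
      All (λ x → evalPoly p (+ x) ≡ f x) X → ∀ {x} → x ∈ X → evalPoly r (+ x) ≡ f x
    agree q≡p p≡f x∈X =
      trans (r≡q _) (trans (q≡p _ (rootProduct-root (∈-map⁺ +_ x∈X))) (All.lookup p≡f x∈X))

  module _ {V W : Pred} where

    data Companions (B : List ℕ) : List ℕ → List ℕ → Set where
      []   : Companions B [] []
      cons : ∀ {a A c Cs} → V c → W c → rootProduct (map +_ B) (+ a) ∣ + c - + a → c ∉ Cs →
             Companions B A Cs → Companions B (a ∷ A) (c ∷ Cs)

    companions : Bridge V W → ∀ {A B} → All V A → All W B → All (_∉ B) A → ¬ ¬ ∃ (Companions B A)
    companions bridge []        wB []           = λ ¬cs → ¬cs ([] , [])
    companions bridge (va ∷ vA) wB (a∉B ∷ A∉B) = do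
      Cs , cs ← companions bridge vA wB A∉B
      c , max<c , vc , wc , c≡a ← bridge va wB a∉B (max 0 Cs)
      pure (c ∷ Cs , cons vc wc c≡a (max<⇒∉ max<c) cs)
      where open RawMonad ¬¬-Monad

    companions-V : ∀ {A B Cs} → Companions B A Cs → All V Cs
    companions-V []                 = []
    companions-V (cons vc _ _ _ cs) = vc ∷ companions-V cs

    companions-W : ∀ {A B Cs} → Companions B A Cs → All W Cs
    companions-W []                 = []
    companions-W (cons _ wc _ _ cs) = wc ∷ companions-W cs

    companions-unique : ∀ {A B Cs} → Companions B A Cs → Unique Cs
    companions-unique []                     = []
    companions-unique (cons _ _ _ c∉Cs cs) = All.¬Any⇒All¬ _ c∉Cs ∷ companions-unique cs

    companions-∈⟨⟩ : ∀ {A B Cs} → Companions B A Cs →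
      rootProduct (map +_ Cs) ∈⟨ rootProduct (map +_ A) , rootProduct (map +_ B) ⟩
    companions-∈⟨⟩ {B = B} [] = 1∈⟨1,β⟩ (rootProduct (map +_ B))
    companions-∈⟨⟩ {a ∷ A} {B} {c ∷ Cs} (cons _ _ c≡a _ cs) =
      ∈⟨⟩-* {β = rootProduct (map +_ B)} (idᴾ -ᴾ constᴾ (+ a)) (rootProductᴾ (map +_ Cs))
            (linear-∈⟨⟩ (rootProductᴾ (map +_ B)) c≡a) (companions-∈⟨⟩ cs)

    module _ {f} (bridge : Bridge V W) (lipV : LIP V f) (lipW : LIP W f) where

      interpolable-disjoint : ∀ {A B} → All V A → All W B → All (_∉ B) A → ¬ ¬ Interpolable f (A ++ B)
      interpolable-disjoint {A} {B} vA wB A∉B = ¬¬-map interpolable (companions bridge vA wB A∉B)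
        where
        interpolable : ∃ (Companions B A) → Interpolable f (A ++ B)
        interpolable (Cs , cs) = glue-interpolants (companions-unique cs) (companions-∈⟨⟩ cs)
          (lipV (A ++ Cs) (All.++⁺ vA (companions-V cs))) (lipW (B ++ Cs) (All.++⁺ wB (companions-W cs)))

      LIP-∪ : LIP (λ x → V x ⊎ W x) f
      LIP-∪ X X⊆V∪W with A , B , vA , wB , X⊆A++B ← partition-⊎ X⊆V∪W =
        interpolable-⊆ (A++B⊆A++B′ ∘ X⊆A++B)
          (interpolable-stable (interpolable-disjoint vA (All.filter⁺ (_∉? A) wB) A∉B′))
        where
        B′ = filter (_∉? A) B
        A∉B′ : All (_∉ B′) A
        A∉B′ = All.tabulate λ a∈A a∈B′ → All.lookup (All.all-filter (_∉? A) B) a∈B′ a∈A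
        A++B⊆A++B′ : A ++ B ⊆ A ++ B′
        A++B⊆A++B′ {y} y∈A++B with ∈-++⁻ A y∈A++B
        ... | inj₁ y∈A = ∈-++⁺ˡ y∈A
        ... | inj₂ y∈B with y ∈? A
        ...   | yes y∈A = ∈-++⁺ˡ y∈A
        ...   | no  y∉A = ∈-++⁺ʳ A (∈-filter⁺ (_∉? A) y∈B y∉A)

  Bridge-Σ : ∀ {I : Set} {U : I → Pred} {W} → (∀ i → Bridge (U i) W) → Bridge (λ x → Σ I λ i → U i x) W
  Bridge-Σ bridges (i , a∈Uᵢ) B⊆W a∉B K =
    ¬¬-map (λ (c , K<c , c∈Uᵢ , c∈W , c≡a) → c , K<c , (i , c∈Uᵢ) , c∈W , c≡a) (bridges i a∈Uᵢ B⊆W a∉B K)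

open Gluing

module SquareFreeDivisibility where

  open import Data.Nat using (zero; suc; _*_; NonZero; ≢-nonZero; ≢-nonZero⁻¹)
  open import Data.Nat.Properties using (*-comm; *-assoc)
  open import Data.Nat.Divisibility
  open import Data.Nat.DivMod using (_/_; m/n*n≡m)
  open import Data.Nat.GCD using (gcd; gcd[m,n]∣m; gcd[m,n]∣n; gcd-greatest; gcd[m,n]≢0)
  open import Data.Nat.Coprimality using (Coprime; coprime-/gcd; coprime-divisor)
  open import Data.Nat.ListAction using (product)
  open import Data.List using ([]; _∷_)
  open import Data.List.Relation.Unary.All as All using (All; []; _∷_)
  open import Data.Product using (_,_)
  open import Data.Sum using (inj₁)
  open import Relation.Binary.PropositionalEquality

  squarefree⇒nonZero : ∀ {g} → SquareFree g → NonZero g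
  squarefree⇒nonZero {zero}  sf with () ← sf 0 (divides 0 refl)
  squarefree⇒nonZero {suc g} sf = _

  squarefree-∣ : ∀ {g d} → SquareFree g → d ∣ g → SquareFree d
  squarefree-∣ sf d∣g m m²∣d = sf m (∣-trans m²∣d d∣g)

  squarefree⇒coprime : ∀ {m n} → SquareFree (m * n) → Coprime m n
  squarefree⇒coprime sf {d} (d∣m , d∣n) = sf d (*-pres-∣ d∣m d∣n)

  coprime-*-∣ : ∀ {m n k} → Coprime m n → m ∣ k → n ∣ k → m * n ∣ k
  coprime-*-∣ {m} {n} cop m∣k (divides q refl) =
    *-monoˡ-∣ n (coprime-divisor cop (subst (m ∣_) (*-comm q n) m∣k))

  -- Split g = (g / g₁) · g₁ with g₁ = gcd g F: the cofactor is coprime to F / g₁, so it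
  -- divides the rest of the product, and it is coprime to g₁ because g is square-free.
  squarefree-∣-product : ∀ {g h} Fs → SquareFree g → g ∣ product Fs →
    All (λ F → gcd g F ∣ h) Fs → g ∣ h
  squarefree-∣-product {g} {h} []       sf g∣1 [] = subst (_∣ h) (sym (∣1⇒≡1 g∣1)) (1∣ h)
  squarefree-∣-product {g} {h} (F ∷ Fs) sf g∣FP (g₁∣h ∷ gcds∣h) =
    subst (_∣ h) g₂g₁≡g (coprime-*-∣ (squarefree⇒coprime (subst SquareFree (sym g₂g₁≡g) sf)) g₂∣h g₁∣h)
    where
    instance
      _ = squarefree⇒nonZero sf
      _ = ≢-nonZero (gcd[m,n]≢0 g F (inj₁ (≢-nonZero⁻¹ g)))
    g₁ = gcd g F
    g₂ = g / g₁
    g₂g₁≡g : g₂ * g₁ ≡ g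
    g₂g₁≡g = m/n*n≡m (gcd[m,n]∣m g F)
    FP≡ : F * product Fs ≡ F / g₁ * product Fs * g₁
    FP≡ = begin
      F * product Fs                ≡⟨ cong (_* product Fs) (m/n*n≡m (gcd[m,n]∣n g F)) ⟨
      F / g₁ * g₁ * product Fs      ≡⟨ *-assoc (F / g₁) g₁ (product Fs) ⟩
      F / g₁ * (g₁ * product Fs)    ≡⟨ cong (F / g₁ *_) (*-comm g₁ (product Fs)) ⟩
      F / g₁ * (product Fs * g₁)    ≡⟨ *-assoc (F / g₁) (product Fs) g₁ ⟨
      F / g₁ * product Fs * g₁      ∎
      where open ≡-Reasoning
    g₂∣g : g₂ ∣ g
    g₂∣g = divides g₁ (trans (sym g₂g₁≡g) (*-comm g₂ g₁))
    g₂∣F′P : g₂ ∣ F / g₁ * product Fs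
    g₂∣F′P = *-cancelʳ-∣ g₁ (subst₂ _∣_ (sym g₂g₁≡g) FP≡ g∣FP)
    g₂∣h : g₂ ∣ h
    g₂∣h = squarefree-∣-product Fs (squarefree-∣ sf g₂∣g) (coprime-divisor (coprime-/gcd g F) g₂∣F′P)
      (All.map (∣-trans (gcd-greatest (∣-trans (gcd[m,n]∣m g₂ _) g₂∣g) (gcd[m,n]∣n g₂ _))) gcds∣h)

open SquareFreeDivisibility

module Congruences where

  open import Data.Nat as ℕ using (NonZero)
  open import Data.Nat.GCD using (gcd; gcd-GCD; module Bézout)
  open import Data.Integer using (+_; -_; _+_; _*_; _-_)
  open import Data.Integer.Properties using (pos-+; pos-*)
  open import Data.Integer.DivMod using (_%ℕ_; _/ℕ_; a≡a%ℕn+[a/ℕn]*n)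
  open import Data.Integer.Divisibility.Signed using (_∣_; divides; ∣-trans; ∣m∣n⇒∣m+n; ∣m⇒∣-m)
  open import Data.Integer.Tactic.RingSolver using (solve-∀)
  open import Data.Product using (∃₂; _,_)
  open import Relation.Binary.PropositionalEquality

  infix 4 _≡_[mod_]

  -- A record rather than d ∣ x - y, so that x, y and d can be inferred from a congruence.
  record _≡_[mod_] (x y d : ℤ) : Set where
    constructor from-∣
    field to-∣ : d ∣ x - y

  open _≡_[mod_] public

  ≡-mod-sym : ∀ {x y d} → x ≡ y [mod d ] → y ≡ x [mod d ]
  ≡-mod-sym {x} {y} (from-∣ d∣x-y) = from-∣ (subst (_ ∣_) (negate x y) (∣m⇒∣-m d∣x-y))
    where
    negate : ∀ x y → - (x - y) ≡ y - x
    negate = solve-∀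

  ≡-mod-trans : ∀ {x y z d} → x ≡ y [mod d ] → y ≡ z [mod d ] → x ≡ z [mod d ]
  ≡-mod-trans {x} {y} {z} (from-∣ d∣x-y) (from-∣ d∣y-z) =
    from-∣ (subst (_ ∣_) (telescope x y z) (∣m∣n⇒∣m+n d∣x-y d∣y-z))
    where
    telescope : ∀ x y z → x - y + (y - z) ≡ x - z
    telescope = solve-∀

  ≡-mod-∣ : ∀ {x y d k} → k ∣ d → x ≡ y [mod d ] → x ≡ y [mod k ]
  ≡-mod-∣ k∣d (from-∣ d∣x-y) = from-∣ (∣-trans k∣d d∣x-y)

  pos-+* : ∀ a k d → + (a ℕ.+ k ℕ.* d) ≡ + a + + k * + d
  pos-+* a k d = trans (pos-+ a (k ℕ.* d)) (cong (λ m → + a + m) (pos-* k d))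

  AP⇒≡-mod : ∀ {a d x} → AP a d x → + x ≡ + a [mod + d ]
  AP⇒≡-mod {a} {d} (k , refl) = from-∣ (divides (+ k) (begin
    + (a ℕ.+ k ℕ.* d) - + a    ≡⟨ cong (_- + a) (pos-+* a k d) ⟩
    + a + + k * + d - + a      ≡⟨ cancel (+ a) (+ k * + d) ⟩
    + k * + d                  ∎))
    where
    open ≡-Reasoning
    cancel : ∀ a m → a + m - a ≡ m
    cancel = solve-∀

  ≡-mod⇒APℤ : ∀ {a d x} → + x ≡ + a [mod + d ] → APℤ a d x
  ≡-mod⇒APℤ {a} {d} {x} (from-∣ (divides q x-a≡)) =
    q , trans (restore (+ x) (+ a)) (cong (λ m → + a + m) x-a≡)
    where
    restore : ∀ x a → x ≡ a + (x - a)
    restore = solve-∀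

  residue-progression : ∀ y L .{{_ : NonZero L}} j → + (y %ℕ L ℕ.+ j ℕ.* L) ≡ y [mod + L ]
  residue-progression y L j = from-∣ (divides (+ j - y /ℕ L) (begin
    + (y %ℕ L ℕ.+ j ℕ.* L) - y
      ≡⟨ cong₂ _-_ (pos-+* (y %ℕ L) j L) (a≡a%ℕn+[a/ℕn]*n y L) ⟩
    + (y %ℕ L) + + j * + L - (+ (y %ℕ L) + y /ℕ L * + L)
      ≡⟨ cancel (+ (y %ℕ L)) (+ j) (y /ℕ L) (+ L) ⟩
    (+ j - y /ℕ L) * + L ∎))
    where
    open ≡-Reasoning
    cancel : ∀ r j q L → r + j * L - (r + q * L) ≡ (j - q) * L
    cancel = solve-∀

  private
    cast : ∀ {g a b c d} → g ℕ.+ a ℕ.* b ≡ c ℕ.* d → + g + + a * + b ≡ + c * + d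
    cast {g} {a} {b} {c} {d} eq = begin
      + g + + a * + b      ≡⟨ cong (λ k → + g + k) (pos-* a b) ⟨
      + g + + (a ℕ.* b)    ≡⟨ pos-+ g (a ℕ.* b) ⟨
      + (g ℕ.+ a ℕ.* b)    ≡⟨ cong +_ eq ⟩
      + (c ℕ.* d)          ≡⟨ pos-* c d ⟩
      + c * + d            ∎
      where open ≡-Reasoning

    isolate : ∀ {g a b} → g + a ≡ b → g ≡ b - a
    isolate {g} {a} eq = trans (sym (cancel g a)) (cong (_- a) eq)
      where
      cancel : ∀ g a → g + a - a ≡ g
      cancel = solve-∀

  bézout : ∀ m n → ∃₂ λ s t → + gcd m n ≡ s * + m + t * + n
  bézout m n with Bézout.identity (gcd-GCD m n)
  ... | Bézout.+- x y eq = + x , - + y ,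
    trans (isolate (cast {gcd m n} {y} {n} {x} {m} eq)) (rearrange (+ x) (+ m) (+ y) (+ n))
    where
    rearrange : ∀ x m y n → x * m - y * n ≡ x * m + - y * n
    rearrange = solve-∀
  ... | Bézout.-+ x y eq = - + x , + y ,
    trans (isolate (cast {gcd m n} {x} {m} {y} {n} eq)) (rearrange (+ x) (+ m) (+ y) (+ n))
    where
    rearrange : ∀ x m y n → y * n - x * m ≡ - x * m + y * n
    rearrange = solve-∀

  crt : ∀ {a b} m n → a ≡ b [mod + gcd m n ] → ∃ λ y → y ≡ a [mod + m ] × y ≡ b [mod + n ]
  crt {a} {b} m n (from-∣ (divides k a-b≡)) with s , t , g≡ ← bézout m n =
    a - k * s * + m , from-∣ (divides (- (k * s)) (shift a k s (+ m))) , from-∣ (divides (k * t) (begin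
      a - k * s * + m - b                   ≡⟨ regroup a b (k * s * + m) ⟩
      a - b - k * s * + m                   ≡⟨ cong (λ d → d - k * s * + m) a-b≡ ⟩
      k * + gcd m n - k * s * + m           ≡⟨ cong (λ g → k * g - k * s * + m) g≡ ⟩
      k * (s * + m + t * + n) - k * s * + m ≡⟨ expand k s t (+ m) (+ n) ⟩
      k * t * + n                           ∎))
    where
    open ≡-Reasoning
    shift : ∀ a k s m → a - k * s * m - a ≡ - (k * s) * m
    shift = solve-∀
    regroup : ∀ a b c → a - c - b ≡ a - b - c
    regroup = solve-∀
    expand : ∀ k s t m n → k * (s * m + t * n) - k * s * m ≡ k * t * n
    expand = solve-∀

open Congruences

module Density where

  open import Data.Nat using (suc; _+_; _*_; _≤_; _<_; z≤n; s≤s; >-nonZero)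
  import Data.Nat.Properties
  open import Data.Nat.Properties
    using (≤-refl; ≤-trans; <⇒≤; <⇒≱; n≤1+n; m≤m+n; m≤n+m; m≤m*n; +-suc; +-mono-≤; +-monoʳ-≤;
           *-monoˡ-≤; +-cancelʳ-≤; *-cancelˡ-≤; +-cancelˡ-≡; *-cancelʳ-≡)
  open import Data.Nat.Tactic.RingSolver using (solve-∀)
  open import Data.List using (List; []; _∷_; length; map; upTo)
  open import Data.List.Properties using (length-map; length-upTo)
  open import Data.List.Membership.Propositional.Properties using (∈-upTo⁻)
  open import Data.List.Relation.Binary.Subset.Propositional using (_⊆_)
  open import Data.List.Relation.Binary.Subset.Propositional.Properties using (All-resp-⊇; ∷⁺ʳ)
  open import Data.List.Relation.Unary.All as All using (All; []; _∷_)
  import Data.List.Relation.Unary.All.Properties as All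
  open import Data.List.Relation.Unary.Any using (there)
  open import Data.List.Relation.Unary.Unique.Propositional using (Unique; []; _∷_)
  import Data.List.Relation.Unary.Unique.Propositional.Properties as Unique
  open import Data.Product using (∃₂; _,_)
  open import Data.Sum using (_⊎_; inj₁; inj₂)
  open import Function using (_∘_)
  open import Data.Empty using (⊥)
  open import Level using (0ℓ)
  open import Relation.Nullary using (¬_)
  open import Relation.Nullary.Negation using (¬¬-Monad; ¬¬-map)
  open import Relation.Binary.PropositionalEquality

  partition-unique : ∀ {P Q : Pred} {xs} → Unique xs → All (λ x → P x ⊎ Q x) xs →
    ∃₂ λ ys zs → length ys + length zs ≡ length xs ×
      (Unique ys × All P ys × ys ⊆ xs) × (Unique zs × All Q zs × zs ⊆ xs)
  partition-unique [] [] = [] , [] , refl , ([] , [] , λ ()) , ([] , [] , λ ())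
  partition-unique {xs = x ∷ _} (x∉xs ∷ xs!) (inj₁ px ∷ pqs)
    with ys , zs , len , (ys! , pys , ys⊆) , (zs! , qzs , zs⊆) ← partition-unique xs! pqs =
    x ∷ ys , zs , cong suc len ,
    (All-resp-⊇ ys⊆ x∉xs ∷ ys! , px ∷ pys , ∷⁺ʳ x ys⊆) , (zs! , qzs , there ∘ zs⊆)
  partition-unique {xs = x ∷ _} (x∉xs ∷ xs!) (inj₂ qx ∷ pqs)
    with ys , zs , len , (ys! , pys , ys⊆) , (zs! , qzs , zs⊆) ← partition-unique xs! pqs =
    ys , x ∷ zs , trans (+-suc (length ys) (length zs)) (cong suc len) ,
    (ys! , pys , there ∘ ys⊆) , (All-resp-⊇ zs⊆ x∉xs ∷ zs! , qx ∷ qzs , ∷⁺ʳ x zs⊆)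

  private
    halves : ∀ k a b n → 2 * k * a ≤ n → 2 * k * b ≤ n → k * (a + b) ≤ n
    halves k a b n 2ka≤n 2kb≤n = *-cancelˡ-≤ 2 (begin
      2 * (k * (a + b))      ≡⟨ expand k a b ⟩
      2 * k * a + 2 * k * b  ≤⟨ +-mono-≤ 2ka≤n 2kb≤n ⟩
      n + n                  ≡⟨ double n ⟩
      2 * n                  ∎)
      where
      open Data.Nat.Properties.≤-Reasoning
      expand : ∀ k a b → 2 * (k * (a + b)) ≡ 2 * k * a + 2 * k * b
      expand = solve-∀
      double : ∀ n → n + n ≡ 2 * n
      double = solve-∀

    1≤2* : ∀ {k} → 1 ≤ k → 1 ≤ 2 * k
    1≤2* {k} k≥1 = ≤-trans k≥1 (m≤m+n k (k + 0))

  DensityZero-∪ : ∀ {C₁ C₂} → DensityZero C₁ → DensityZero C₂ → DensityZero (λ x → C₁ x ⊎ C₂ x)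
  DensityZero-∪ {C₁} {C₂} dz₁ dz₂ k k≥1
    with N₁ , bound₁ ← dz₁ (2 * k) (1≤2* k≥1)
       | N₂ , bound₂ ← dz₂ (2 * k) (1≤2* k≥1) = N₁ + N₂ , bound
    where
    distribute : ∀ {x} {B : Set} → (C₁ x ⊎ C₂ x) × B → (C₁ x × B) ⊎ (C₂ x × B)
    distribute (inj₁ c₁ , b) = inj₁ (c₁ , b)
    distribute (inj₂ c₂ , b) = inj₂ (c₂ , b)
    bound : ∀ n → N₁ + N₂ ≤ n → ∀ xs → Unique xs →
      All (λ x → (C₁ x ⊎ C₂ x) × 1 ≤ x × x ≤ n) xs → k * length xs ≤ n
    bound n N≤n xs xs! xs⊆C
      with ys , zs , len , (ys! , ys⊆C₁ , _) , (zs! , zs⊆C₂ , _)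
             ← partition-unique xs! (All.map distribute xs⊆C) =
      subst (λ l → k * l ≤ n) len (halves k (length ys) (length zs) n
        (bound₁ n (≤-trans (m≤m+n N₁ N₂) N≤n) ys ys! ys⊆C₁)
        (bound₂ n (≤-trans (m≤n+m N₂ N₁) N≤n) zs zs! zs⊆C₂))

  -- The first t = N + y + 1 terms are distinct, lie in [1, y + tL] and are more than
  -- (y + tL) / 2L in number.
  progression-escapes : ∀ {C} → DensityZero C → ∀ {y L} → 1 ≤ y → 1 ≤ L →
    ¬ ¬ ∃ λ j → ¬ C (y + j * L)
  progression-escapes {C} dz {y} {L} y≥1 L≥1 trapped
    with N , bound ← dz (2 * L) (1≤2* L≥1) =
    ¬¬-trapped λ xs⊆C → too-many (subst (λ l → 2 * L * l ≤ n) length-xs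
      (bound n N≤n xs xs! (All.zipWith (λ (c , r) → c , r) (xs⊆C , in-range))))
    where
    instance _ = >-nonZero L≥1
    t n : ℕ
    t = suc (N + y)
    n = y + t * L
    term : ℕ → ℕ
    term j = y + j * L
    xs : List ℕ
    xs = map term (upTo t)
    length-xs : length xs ≡ t
    length-xs = trans (length-map term (upTo t)) (length-upTo t)
    xs! : Unique xs
    xs! = Unique.map⁺ (λ {i} {j} eq → *-cancelʳ-≡ i j L (+-cancelˡ-≡ y _ _ eq)) (Unique.upTo⁺ t)
    ¬¬-trapped : ¬ ¬ All C xs
    ¬¬-trapped = All.sequenceM 0ℓ ¬¬-Monad
      (All.map⁺ {xs = upTo t} {f = term} (All.tabulate (λ {j} _ ¬Cj → trapped (j , ¬Cj))))
    in-range : All (λ x → 1 ≤ x × x ≤ n) xs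
    in-range = All.map⁺ (All.tabulate λ j∈ →
      ≤-trans y≥1 (m≤m+n y _) , +-monoʳ-≤ y (*-monoˡ-≤ L (<⇒≤ (∈-upTo⁻ j∈))))
    N≤n : N ≤ n
    N≤n = ≤-trans (≤-trans (m≤m+n N y) (n≤1+n _)) (≤-trans (m≤m*n t L) (m≤n+m (t * L) y))
    too-many : 2 * L * t ≤ n → ⊥
    too-many 2Lt≤n = <⇒≱ (s≤s (m≤n+m y N)) (≤-trans (m≤m*n t L) tL≤y)
      where
      split : ∀ L t → 2 * L * t ≡ t * L + t * L
      split = solve-∀
      tL≤y : t * L ≤ y
      tL≤y = +-cancelʳ-≤ (t * L) (t * L) y
        (subst (_≤ n) (split L t) 2Lt≤n)

  ContainsProgression : Pred → Set
  ContainsProgression Q = ∃₂ λ R L → 1 ≤ L × ∀ j → 1 ≤ R + j * L → Q (R + j * L)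

  escaping-points : ∀ {C₁ C₂ Q} → DensityZero C₁ → DensityZero C₂ → ContainsProgression Q →
    ∀ K → ¬ ¬ ∃ λ c → K < c × Q c × ¬ C₁ c × ¬ C₂ c
  escaping-points {C₁} {C₂} {Q} dz₁ dz₂ (R , L , L≥1 , progression) K =
    ¬¬-map escape (progression-escapes (DensityZero-∪ dz₁ dz₂) {R + suc K * L} y≥1 L≥1)
    where
    K<K+1L : K < suc K * L
    K<K+1L = ≤-trans (s≤s ≤-refl) (m≤m*n (suc K) L {{>-nonZero L≥1}})
    y≥1 : 1 ≤ R + suc K * L
    y≥1 = ≤-trans (s≤s z≤n) (≤-trans K<K+1L (m≤n+m _ R))
    regroup : ∀ R K j L → R + suc K * L + j * L ≡ R + (suc K + j) * L
    regroup = solve-∀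
    escape : (∃ λ j → ¬ (C₁ (R + suc K * L + j * L) ⊎ C₂ (R + suc K * L + j * L))) →
      ∃ λ c → K < c × Q c × ¬ C₁ c × ¬ C₂ c
    escape (j , escapes) = c , K<c , progression (suc K + j) (≤-trans (s≤s z≤n) K<c) ,
                           escapes′ ∘ inj₁ , escapes′ ∘ inj₂
      where
      c = R + (suc K + j) * L
      escapes′ : ¬ (C₁ c ⊎ C₂ c)
      escapes′ = subst (λ x → ¬ (C₁ x ⊎ C₂ x)) (regroup R K j L) escapes
      K<c : K < c
      K<c = ≤-trans K<K+1L (≤-trans (*-monoˡ-≤ L (m≤m+n (suc K) j)) (m≤n+m _ R))

open Density

module AlmostBasicSets where

  open import Data.Nat as ℕ using (_<_; _≤_; NonZero; >-nonZero; >-nonZero⁻¹)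
  open import Data.Nat.Properties using (m*n≢0)
  import Data.Nat.Divisibility as ℕ
  open import Data.Nat.GCD using (gcd; gcd[m,n]∣m; gcd[m,n]∣n)
  open import Data.Nat.ListAction using (product)
  open import Data.Integer using (+_; _-_; ∣_∣; 0ℤ)
  import Data.Integer.Base as ℤ
  open import Data.Integer.Properties using (abs-*; +-injective)
  open import Data.Integer.DivMod using (_%ℕ_)
  open import Data.Integer.Divisibility.Signed using (_∣_; ∣ᵤ⇒∣; ∣⇒∣ᵤ; ∣-trans; m∣∣m∣)
  open import Data.List using ([]; _∷_; map)
  open import Data.List.Membership.Propositional using (_∈_; _∉_)
  open import Data.List.Membership.Propositional.Properties using (∈-map⁻)
  open import Data.List.Relation.Unary.All as All using (All; []; _∷_)
  import Data.List.Relation.Unary.All.Properties as All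
  open import Data.Product using (_,_; proj₁; proj₂)
  open import Relation.Nullary using (¬_)
  open import Relation.Nullary.Negation using (¬¬-map)
  open import Relation.Binary.PropositionalEquality

  ∣rootProduct∣ : ∀ a bs → ∣ rootProduct (map +_ bs) a ∣ ≡ product (map (λ b → ∣ a - + b ∣) bs)
  ∣rootProduct∣ a []       = refl
  ∣rootProduct∣ a (b ∷ bs) =
    trans (abs-* (a - + b) (rootProduct (map +_ bs) a)) (cong (∣ a - + b ∣ ℕ.*_) (∣rootProduct∣ a bs))

  -- The compatibility condition for the Chinese remainder theorem in common-progression.
  -- As d₂ is square-free it can be checked factor by factor of d₁ · ∏ (a - b): the common
  -- point c₀ takes care of d₁, and b ≡ a₂ (mod d₂) of a - b.
  offset-≡-mod-gcd : ∀ {a a₁ d₁ a₂ d₂ c₀ B} → SquareFree d₂ →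
    AP a₁ d₁ a → AP a₁ d₁ c₀ → AP a₂ d₂ c₀ → All (AP a₂ d₂) B →
    + a ≡ + a₂ [mod + gcd (d₁ ℕ.* ∣ rootProduct (map +_ B) (+ a) ∣) d₂ ]
  offset-≡-mod-gcd {a} {a₁} {d₁} {a₂} {d₂} {c₀} {B} sf a∈P₁ c₀∈P₁ c₀∈P₂ B⊆P₂ =
    from-∣ (∣ᵤ⇒∣ (squarefree-∣-product (d₁ ∷ map (λ b → ∣ + a - + b ∣) B) (squarefree-∣ sf g∣d₂)
                   (subst (λ P → g ℕ.∣ d₁ ℕ.* P) (∣rootProduct∣ (+ a) B) (gcd[m,n]∣m G d₂))
                   (via-d₁ ∷ All.map⁺ (All.map via-b B⊆P₂))))
    where
    G = d₁ ℕ.* ∣ rootProduct (map +_ B) (+ a) ∣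
    g = gcd G d₂
    g∣d₂ : g ℕ.∣ d₂
    g∣d₂ = gcd[m,n]∣n G d₂
    via-d₁ : gcd g d₁ ℕ.∣ ∣ + a - + a₂ ∣
    via-d₁ = ∣⇒∣ᵤ (to-∣ (≡-mod-trans (≡-mod-∣ e∣d₁ (AP⇒≡-mod a∈P₁))
                         (≡-mod-trans (≡-mod-∣ e∣d₁ (≡-mod-sym (AP⇒≡-mod c₀∈P₁)))
                                      (≡-mod-∣ e∣d₂ (AP⇒≡-mod c₀∈P₂)))))
      where
      e∣d₁ : + gcd g d₁ ∣ + d₁
      e∣d₁ = ∣ᵤ⇒∣ (gcd[m,n]∣n g d₁)
      e∣d₂ : + gcd g d₁ ∣ + d₂
      e∣d₂ = ∣ᵤ⇒∣ (ℕ.∣-trans (gcd[m,n]∣m g d₁) g∣d₂)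
    via-b : ∀ {b} → AP a₂ d₂ b → gcd g ∣ + a - + b ∣ ℕ.∣ ∣ + a - + a₂ ∣
    via-b {b} b∈P₂ = ∣⇒∣ᵤ (to-∣ (≡-mod-trans a≡b (≡-mod-∣ e∣d₂ (AP⇒≡-mod b∈P₂))))
      where
      a≡b : + a ≡ + b [mod + gcd g ∣ + a - + b ∣ ]
      a≡b = from-∣ (∣ᵤ⇒∣ (gcd[m,n]∣n g ∣ + a - + b ∣))
      e∣d₂ : + gcd g ∣ + a - + b ∣ ∣ + d₂
      e∣d₂ = ∣ᵤ⇒∣ (ℕ.∣-trans (gcd[m,n]∣m g ∣ + a - + b ∣) g∣d₂)

  +-∉ : ∀ {a B} → a ∉ B → + a ∉ map +_ B
  +-∉ {B = B} a∉B +a∈B with b , b∈B , +a≡+b ← ∈-map⁻ +_ +a∈B =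
    a∉B (subst (_∈ B) (sym (+-injective +a≡+b)) b∈B)

  ≡-mod⇒AP : ∀ {a d x} → BasicSet a d → 1 ≤ x → + x ≡ + a [mod + d ] → AP a d x
  ≡-mod⇒AP {x = x} basic x≥1 x≡a = proj₂ (BasicSet.full basic x x≥1) (≡-mod⇒APℤ x≡a)

  common-progression : ∀ {a a₁ d₁ a₂ d₂ N} → BasicSet a₁ d₁ → BasicSet a₂ d₂ → N ≢ 0ℤ →
    AP a₁ d₁ a → + a ≡ + a₂ [mod + gcd (d₁ ℕ.* ∣ N ∣) d₂ ] →
    ContainsProgression (λ c → AP a₁ d₁ c × AP a₂ d₂ c × + c ≡ + a [mod N ])
  common-progression {a} {a₁} {d₁} {a₂} {d₂} {N} basic₁ basic₂ N≢0 a∈P₁ a≡a₂ =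
    residues (crt (d₁ ℕ.* ∣ N ∣) d₂ a≡a₂)
    where
    G = d₁ ℕ.* ∣ N ∣
    L = G ℕ.* d₂
    instance
      d₁≢0 : NonZero d₁
      d₁≢0 = >-nonZero (KirchAP.d≥1 (BasicSet.kirch basic₁))
      d₂≢0 : NonZero d₂
      d₂≢0 = >-nonZero (KirchAP.d≥1 (BasicSet.kirch basic₂))
      ∣N∣≢0 : NonZero ∣ N ∣
      ∣N∣≢0 = ℤ.≢-nonZero N≢0
      L≢0 : NonZero L
      L≢0 = m*n≢0 G d₂ {{m*n≢0 d₁ ∣ N ∣}}
    G∣L : + G ∣ + L
    G∣L = ∣ᵤ⇒∣ (ℕ.m∣m*n d₂)
    N∣G : N ∣ + G
    N∣G = ∣-trans m∣∣m∣ (∣ᵤ⇒∣ (ℕ.n∣m*n d₁))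
    N∣L : N ∣ + L
    N∣L = ∣-trans N∣G G∣L
    d₁∣G : + d₁ ∣ + G
    d₁∣G = ∣ᵤ⇒∣ (ℕ.m∣m*n ∣ N ∣)
    d₁∣L : + d₁ ∣ + L
    d₁∣L = ∣-trans d₁∣G G∣L
    d₂∣L : + d₂ ∣ + L
    d₂∣L = ∣ᵤ⇒∣ (ℕ.n∣m*n G)
    residues : (∃ λ y₀ → y₀ ≡ + a [mod + G ] × y₀ ≡ + a₂ [mod + d₂ ]) →
      ContainsProgression (λ c → AP a₁ d₁ c × AP a₂ d₂ c × + c ≡ + a [mod N ])
    residues (y₀ , y₀≡a , y₀≡a₂) = y₀ %ℕ L , L , >-nonZero⁻¹ L , λ j c≥1 →
      ≡-mod⇒AP basic₁ c≥1 (≡-mod-trans (≡-mod-∣ d₁∣L (residue-progression y₀ L j))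
                                        (≡-mod-trans (≡-mod-∣ d₁∣G y₀≡a) (AP⇒≡-mod a∈P₁))) ,
      ≡-mod⇒AP basic₂ c≥1 (≡-mod-trans (≡-mod-∣ d₂∣L (residue-progression y₀ L j)) y₀≡a₂) ,
      ≡-mod-trans (≡-mod-∣ N∣L (residue-progression y₀ L j)) (≡-mod-∣ N∣G y₀≡a)

  almostBasic-bridge : ∀ {U W} → AlmostBasic U → AlmostBasic W → (∃ λ c → U c × W c) → Bridge U W
  almostBasic-bridge {U} {W} (a₁ , d₁ , basic₁ , C₁ , _ , dz₁ , U⇔)
                             (a₂ , d₂ , basic₂ , C₂ , _ , dz₂ , W⇔)
                             (c₀ , c₀∈U , c₀∈W) {a} a∈U {B} B⊆W a∉B K =
    ¬¬-map companion (escaping-points dz₁ dz₂ progression K)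
    where
    in-P₁ : ∀ {x} → U x → AP a₁ d₁ x
    in-P₁ {x} x∈U = proj₁ (proj₁ (U⇔ x) x∈U)
    in-P₂ : ∀ {x} → W x → AP a₂ d₂ x
    in-P₂ {x} x∈W = proj₁ (proj₁ (W⇔ x) x∈W)
    N = rootProduct (map +_ B) (+ a)
    progression : ContainsProgression (λ c → AP a₁ d₁ c × AP a₂ d₂ c × + c ≡ + a [mod N ])
    progression = common-progression basic₁ basic₂ (rootProduct-nonroot (+-∉ a∉B)) (in-P₁ a∈U)
      (offset-≡-mod-gcd (KirchAP.sqfree (BasicSet.kirch basic₂))
         (in-P₁ a∈U) (in-P₁ c₀∈U) (in-P₂ c₀∈W) (All.map in-P₂ B⊆W))
    companion : (∃ λ c → K < c × (AP a₁ d₁ c × AP a₂ d₂ c × + c ≡ + a [mod N ]) × ¬ C₁ c × ¬ C₂ c) →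
      ∃ λ c → K < c × U c × W c × N ∣ + c - + a
    companion (c , K<c , (c∈P₁ , c∈P₂ , c≡a) , c∉C₁ , c∉C₂) =
      c , K<c , proj₂ (U⇔ c) (c∈P₁ , c∉C₁) , proj₂ (W⇔ c) (c∈P₂ , c∉C₂) , to-∣ c≡a

open AlmostBasicSets

mainTheorem2 : (n : ℕ) (U : Fin n → Pred) → (∀ i → AlmostBasic (U i)) →
    (∀ i j → ∃ λ x → U i x × U j x) →
    (f : ℕ → ℤ) → (∀ i → LIP (U i) f) →
    LIP (λ x → Σ (Fin n) λ i → U i x) f
mainTheorem2 zero    U _           _    f _   X X⊆∅ = [] , All.map (λ { (() , _) }) X⊆∅
mainTheorem2 (suc n) U almostBasic meet f lip = LIP-mono split (LIP-∪ bridge lip-rest (lip zero))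
  where
  bridge : Bridge (λ x → Σ (Fin n) λ i → U (suc i) x) (U zero)
  bridge = Bridge-Σ λ i → almostBasic-bridge (almostBasic (suc i)) (almostBasic zero) (meet (suc i) zero)
  lip-rest : LIP (λ x → Σ (Fin n) λ i → U (suc i) x) f
  lip-rest = mainTheorem2 n (U ∘ suc) (almostBasic ∘ suc) (λ i j → meet (suc i) (suc j)) f (lip ∘ suc)
  split : ∀ {x} → Σ (Fin (suc n)) (λ i → U i x) → Σ (Fin n) (λ i → U (suc i) x) ⊎ U zero x
  split (zero  , x∈U₀) = inj₂ x∈U₀
  split (suc i , x∈Uᵢ) = inj₁ (i , x∈Uᵢ)
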